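{- Let $k\ge1$, let $a=a_1\mathbin{+\!\!+}\cdots\mathbin{+\!\!+}a_m\in\mathcal{T}^*$ with $a_1,\dots,a_m\in\mathcal{T}^*$, and let $j\in\{1,\dots,m\}$. If $a_j>_k a_j'$, then $a>_k a_1\mathbin{+\!\!+}\cdots\mathbin{+\!\!+}a_{j-1}\mathbin{+\!\!+}a_j'\mathbin{+\!\!+}a_{j+1}\mathbin{+\!\!+}\cdots\mathbin{+\!\!+}a_m$.
   Context: $\mathcal{F}$ is a signature partitioned into defined symbols $\mathcal{D}$ and constructors $\mathcal{C}$, with a quasi-precedence $\succsim$ (preorder with well-founded strict part $\succ$, equivalence $\sim$). $s\approx t$ iff $s=t$ or $s=f(s_1,\dots,s_n)$, $t=g(t_1,\dots,t_n)$, $f\sim g$ and $s_i\approx t_i$ for all $i$. $f(s_1,\dots,s_m)\rhd t$ iff $s_i\unrhd t$ for some $i$, ${\unrhd}={\rhd}\cup{\approx}$. $\mathcal{T}^*$ is the set of finite lists $[t_1\cdots t_n]$ ($n\ge0$) of terms over $\mathcal{F}$ and variables; a term $t$ is identified with $[t]$; $\mathbin{+\!\!+}$ is concatenation. For $k\ge1$, $>_k$ is the least relation on $\mathcal{T}^*$ with $a>_k b$ if: (1) $a=f(s_1,\dots,s_m)$ and $s_i\ge_k b$ for some $i$; or (2) $a=f(s_1,\dots,s_m)$, $f\in\mathcal{D}$, $b=[t_1\cdots t_n]$ with $n=0$ or $2\le n\le k$, and $a>_k t_j$ for all $j$; or (3) $a=f(s_1,\dots,s_m)$, $b=g(t_1,\dots,t_n)$,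 $n\le k$, $f\in\mathcal{D}$, $f\succ g$, $a\rhd t_j$ for all $j$; or (4) $a=[s_1\cdots s_m]$, $b=b_1\mathbin{+\!\!+}\cdots\mathbin{+\!\!+}b_m$, and for some $j$: $s_i\approx b_i$ ($i<j$), $s_j>_k b_j$, $s_i\ge_k b_i$ ($i>j$); or (5) $a=f(s_1,\dots,s_m)$, $b=g(t_1,\dots,t_n)$, $n\le k$, $f,g\in\mathcal{D}$, $f\sim g$, and for some $j\le\min(m,n)$: $s_i\approx t_i$ ($i<j$), $s_j\rhd t_j$, $a\rhd t_i$ ($i>j$). ${\ge_k}={>_k}\cup{\approx}$. -}

module Defs where

open import Level using (0ℓ)
open import Data.Nat using (ℕ; _≤_; _<_)
open import Data.List using (List; []; _∷_; length; concat)
import Data.List.Relation.Unary.All as ListAll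
import Data.List.Relation.Binary.Pointwise as ListPW
open import Data.Vec using (Vec; toList)
import Data.Vec.Relation.Unary.Any as VecAny
import Data.Vec.Relation.Unary.All as VecAll
import Data.Vec.Relation.Binary.Pointwise.Inductive as VecPW
open import Data.Product using (_×_)
open import Data.Sum using (_⊎_)
open import Relation.Nullary using (¬_)
open import Relation.Binary.Core using (Rel)
open import Relation.Binary.Structures using (IsPreorder)
open import Relation.Binary.PropositionalEquality using (_≡_)
open import Induction.WellFounded using (WellFounded)

record Sig : Set₁ where
  field
    Sym      : Set
    Var      : Set
    arity    : Sym → ℕ
    Defined  : Sym → Set                 -- f ∈ D ; f ∈ C iff ¬ Defined f
    _≿_      : Rel Sym 0ℓ
    isPreorder : IsPreorder _≡_ _≿_

  _≻_ : Rel Sym 0ℓ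
  f ≻ g = (f ≿ g) × ¬ (g ≿ f)

  _∼_ : Rel Sym 0ℓ
  f ∼ g = (f ≿ g) × (g ≿ f)

  field
    ≻-wf : WellFounded _≻_

module Rel (S : Sig) where
  open Sig S

  data Term : Set where
    var : Var → Term
    fun : (f : Sym) → Vec Term (arity f) → Term

  data _≈_ : Term → Term → Set where
    ≈-eq  : ∀ {s} → s ≈ s
    ≈-fun : ∀ {f g ss ts} → f ∼ g → VecPW.Pointwise _≈_ ss ts → fun f ss ≈ fun g ts

  mutual
    data _▷_ : Term → Term → Set where
      ▷-arg : ∀ {f ss t} → VecAny.Any (_⊵ t) ss → fun f ss ▷ t

    data _⊵_ : Term → Term → Set where
      ⊵-▷ : ∀ {s t} → s ▷ t → s ⊵ t
      ⊵-≈ : ∀ {s t} → s ≈ t → s ⊵ t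

  -- T* : finite lists of terms; a term t is identified with [ t ]
  T* : Set
  T* = List Term

  [_] : Term → T*
  [ t ] = t ∷ []

  _≈*_ : T* → T* → Set
  _≈*_ = ListPW.Pointwise _≈_

  -- auxiliary for rule (5): for some j ≤ min(m,n):
  --   s_i ≈ t_i (i<j), s_j ▷ t_j, a ▷ t_i (i>j)
  data Lex5 (a : Term) : List Term → List Term → Set where
    here  : ∀ {s ss t ts} → s ▷ t → ListAll.All (a ▷_) ts → Lex5 a (s ∷ ss) (t ∷ ts)
    there : ∀ {s ss t ts} → s ≈ t → Lex5 a ss ts → Lex5 a (s ∷ ss) (t ∷ ts)

  mutual
    data _>[_]_ : T* → ℕ → T* → Set where
      rule1 : ∀ {k f ss b} → VecAny.Any (λ s → [ s ] ≥[ k ] b) ss → [ fun f ss ] >[ k ] b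
      rule2 : ∀ {k f ss} (b : T*) → Defined f →
              (length b ≡ 0 ⊎ (2 ≤ length b × length b ≤ k)) →
              ListAll.All (λ t → [ fun f ss ] >[ k ] [ t ]) b →
              [ fun f ss ] >[ k ] b
      rule3 : ∀ {k f ss g ts} → arity g ≤ k → Defined f → f ≻ g →
              VecAll.All (fun f ss ▷_) ts → [ fun f ss ] >[ k ] [ fun g ts ]
      rule4 : ∀ {k ss} (bs : List T*) → Lex4 k ss bs → ss >[ k ] concat bs
      rule5 : ∀ {k f ss g ts} → arity g ≤ k → Defined f → Defined g → f ∼ g →
              Lex5 (fun f ss) (toList ss) (toList ts) → [ fun f ss ] >[ k ] [ fun g ts ]

    data _≥[_]_ : T* → ℕ → T* → Set where
      ≥-> : ∀ {a k b} → a >[ k ] b → a ≥[ k ] b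
      ≥-≈ : ∀ {a k b} → a ≈* b → a ≥[ k ] b

    -- rule (4): a = [s_1 … s_m], b = b_1 ++ … ++ b_m, for some j:
    --   s_i ≈ b_i (i<j), s_j >_k b_j, s_i ≥_k b_i (i>j)
    data Lex4 (k : ℕ) : List Term → List T* → Set where
      here  : ∀ {s ss b bs} → [ s ] >[ k ] b →
              ListPW.Pointwise (λ s' b' → [ s' ] ≥[ k ] b') ss bs →
              Lex4 k (s ∷ ss) (b ∷ bs)
      there : ∀ {s ss b bs} → [ s ] ≈* b → Lex4 k ss bs → Lex4 k (s ∷ ss) (b ∷ bs)

-- Every proof of a >_k b, read as a list of lists, is an instance of rule (4): for a single
-- term a this is the one-block decomposition b = [b], and rule (4) itself supplies one.
-- Padding such a decomposition with singleton blocks [s] ≈ [s] on either side is again an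
-- instance of rule (4), so >_k is closed under surrounding both sides by the same context.
module Submission where

open import Defs
open import Data.Nat using (ℕ; _≤_)
open import Data.List using (List; []; _∷_; _++_; concat; map)
open import Data.List.Properties using (concat-++; concat-map-[_]; ++-identityʳ)
import Data.List.Relation.Binary.Pointwise as ListPW
open import Data.Product using (∃; _×_; _,_)
open import Relation.Binary.PropositionalEquality
  using (_≡_; refl; sym; cong; cong₂; subst; subst₂; module ≡-Reasoning)

module _ (S : Sig) where
  open Rel S

  private variable
    k : ℕ
    a b : T*
    bs : List T*

  ≥-refl-[_] : ∀ s → [ s ] ≥[ k ] [ s ]
  ≥-refl-[ s ] = ≥-≈ (≈-eq ListPW.∷ ListPW.[])

  ≥-pointwise-singletons : ∀ ys →
    ListPW.Pointwise (λ s b → [ s ] ≥[ k ] b) ys (map [_] ys)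
  ≥-pointwise-singletons []       = ListPW.[]
  ≥-pointwise-singletons (y ∷ ys) = ≥-refl-[ y ] ListPW.∷ ≥-pointwise-singletons ys

  Lex4-prefix : ∀ ys → Lex4 k a bs → Lex4 k (ys ++ a) (map [_] ys ++ bs)
  Lex4-prefix []       l = l
  Lex4-prefix (y ∷ ys) l = there (≈-eq ListPW.∷ ListPW.[]) (Lex4-prefix ys l)

  Lex4-suffix : ∀ zs → Lex4 k a bs → Lex4 k (a ++ zs) (bs ++ map [_] zs)
  Lex4-suffix zs (here p ps) = here p (ListPW.++⁺ ps (≥-pointwise-singletons zs))
  Lex4-suffix zs (there e l) = there e (Lex4-suffix zs l)

  >⇒Lex4 : a >[ k ] b → ∃ λ bs → Lex4 k a bs × concat bs ≡ b
  >⇒Lex4 (rule4 bs l)          = bs , l , refl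
  >⇒Lex4 p@(rule1 _)           = _ , here p ListPW.[] , ++-identityʳ _
  >⇒Lex4 p@(rule2 _ _ _ _)     = _ , here p ListPW.[] , ++-identityʳ _
  >⇒Lex4 p@(rule3 _ _ _ _)     = _ , here p ListPW.[] , refl
  >⇒Lex4 p@(rule5 _ _ _ _ _)   = _ , here p ListPW.[] , refl

  concat-padded : ∀ ys zs (bs : List T*) →
    concat (map [_] ys ++ bs ++ map [_] zs) ≡ ys ++ concat bs ++ zs
  concat-padded ys zs bs = begin
    concat (map [_] ys ++ bs ++ map [_] zs)
      ≡⟨ concat-++ (map [_] ys) (bs ++ map [_] zs) ⟨
    concat (map [_] ys) ++ concat (bs ++ map [_] zs)
      ≡⟨ cong₂ _++_ concat-map-[ ys ] (sym (concat-++ bs (map [_] zs))) ⟩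
    ys ++ concat bs ++ concat (map [_] zs)
      ≡⟨ cong (λ u → ys ++ concat bs ++ u) concat-map-[ zs ] ⟩
    ys ++ concat bs ++ zs
      ∎
    where open ≡-Reasoning

  >-++-context : ∀ ys zs → a >[ k ] b → (ys ++ a ++ zs) >[ k ] (ys ++ b ++ zs)
  >-++-context {a} {k} ys zs p with >⇒Lex4 p
  ... | bs , l , refl =
    subst ((ys ++ a ++ zs) >[ k ]_) (concat-padded ys zs bs)
      (rule4 (map [_] ys ++ bs ++ map [_] zs) (Lex4-prefix ys (Lex4-suffix zs l)))

lemma1 : (S : Sig) → let open Rel S in
         (k : ℕ) → 1 ≤ k →
         (pre post : List T*) (aj aj′ : T*) →
         aj >[ k ] aj′ →
         concat (pre ++ aj ∷ post) >[ k ] concat (pre ++ aj′ ∷ post)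
lemma1 S k _ pre post aj aj′ p =
  subst₂ (λ x y → Rel._>[_]_ S x k y) (concat-++ pre (aj ∷ post)) (concat-++ pre (aj′ ∷ post))
    (>-++-context S (concat pre) (concat post) p)
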